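{- Let $q$ be a prime power and let $u,v\in\mathbb{F}_{q^3}^*$ with $\mathrm{N}_{q^3/q}(-v/u)\neq1$. Let $\mathcal{B}=\{x\in\mathbb{F}_{q^3}:\mathrm{Tr}_{q^3/q}(u^{q^2}v^qx)=u^{q^2+q+1}+v^{q^2+q+1}\}$. Then for every $\beta\in\mathcal{B}$ the equation $ux^{q^2-1}+vx^{q-1}+\beta=0$ has no solution $x\in\mathbb{F}_{q^3}^*$. Moreover, for any $\theta\in\mathcal{B}$ and $a\in\mathbb{F}_{q^3}^*$, letting $L(X)=u^{q^2}v^q\bigl(ua^{q^2-1}X^{q^2}+va^{q-1}X^q+\theta X\bigr)$, the polynomial $\mathrm{Tr}_{q^3/q}(L(X)/X)$ has no root in $\mathbb{F}_{q^3}^*$.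
   Context: $\mathrm{Tr}_{q^3/q}$ and $\mathrm{N}_{q^3/q}$ denote the trace and norm maps from $\mathbb{F}_{q^3}$ to $\mathbb{F}_q$. -}

module Defs where

open import Level using (Level; _⊔_) renaming (suc to lsuc)
open import Data.Nat using (ℕ; zero; suc; _^_; _≥_)
open import Data.Nat.Primality using (Prime)
open import Data.Fin using (Fin)
open import Data.Product using (Σ; ∃; _×_)
open import Relation.Binary.PropositionalEquality using (_≡_)
open import Relation.Nullary using (¬_)
open import Algebra.Bundles using (CommutativeRing)

IsPrimePower : ℕ → Set
IsPrimePower q = Σ ℕ λ p → Σ ℕ λ k → Prime p × k ≥ 1 × q ≡ p ^ k

record Field (c ℓ : Level) : Set (lsuc (c ⊔ ℓ)) where
  field
    commRing : CommutativeRing c ℓ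
  open CommutativeRing commRing public
  field
    _⁻¹      : Carrier → Carrier
    1≉0      : ¬ (1# ≈ 0#)
    inverseʳ : ∀ x → ¬ (x ≈ 0#) → (x * (x ⁻¹)) ≈ 1#

  pow : Carrier → ℕ → Carrier
  pow x zero    = 1#
  pow x (suc n) = x * pow x n

HasCard : ∀ {c ℓ} → Field c ℓ → ℕ → Set (c ⊔ ℓ)
HasCard F n = Σ (Fin n → Carrier) λ e →
    (∀ i j → e i ≈ e j → i ≡ j) × (∀ x → ∃ λ i → e i ≈ x)
  where open Field F

-- Trace and norm from F_{q^3} to F_q (as elements of F_{q^3})
module _ {c ℓ} (F : Field c ℓ) (q : ℕ) where
  open Field F
  Tr : Carrier → Carrier
  Tr x = x + pow x q + pow x (q ^ 2)

  Nm : Carrier → Carrier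
  Nm x = pow x (q ^ 2 Data.Nat.+ q Data.Nat.+ 1)

module Submission where

open import Defs
open import Level using (Level)
open import Data.Nat using (ℕ; _^_; _∸_) renaming (_+_ to _+ℕ_)
open import Data.Product using (_×_)
open import Relation.Nullary using (¬_)

-- Let F be a field with q³ elements, q = p^k, and write φ x = x^q and
-- ψ x = x^(q²), so that Tr x = x + φ x + ψ x and N x = ψ x · φ x · x.
-- The proof has three layers.
--   * Finite-field facts: in a field with N = p^k elements, translation by 1
--     and multiplication by a unit permute the elements, giving N·1 = 0 (so
--     p·1 = 0) and Fermat's little theorem x^N = x.  Since p divides the
--     middle binomial coefficients C(p,j), x ↦ x^p and hence φ are additive;
--     with x^(q³) = x this makes φ an automorphism of order dividing 3.
--   * The key identity.  For y ≠ 0 let D y = u ψ y + v φ y, and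
--     E y = u^(q²) v^q (u y^(q²-1) + v y^(q-1)), so that y · E y = u^(q²) v^q · D y.
--     Expanding the norm of D y gives
--         y φy ψy · (Tr (E y) + N u + N v) = D y · φ (D y) · ψ (D y),
--     and D y ≠ 0 because D y = 0 would force N(-v/u) = 1.
--     Hence Tr (E y) + N u + N v ≠ 0 for every y ≠ 0.
--   * Both claims of the theorem are this inequality: a root x of the
--     equation gives Tr (E x) = -Tr (u^(q²) v^q β) = -(N u + N v), and the
--     trace in the second claim equals Tr (E (a x)) + N u + N v.

open import Data.Nat using (zero; suc)
open import Data.Nat.Primality using (Prime)
open import Data.Nat.Divisibility using (_∣_; divides)
open import Data.Nat.Combinatorics using (_C_; nCn≡1)
import Data.Nat as ℕ
import Data.Nat.Properties as ℕₚ
open import Data.Fin as Fin using (Fin)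
import Data.Fin.Properties as Finₚ
open import Data.Fin.Permutation using (Permutation; permutation)
open import Data.Product using (_,_; proj₁; proj₂)
open import Data.Empty using (⊥-elim)
open import Relation.Nullary using (Dec; yes; no)
open import Relation.Binary.PropositionalEquality as ≡ using (_≡_)
import Relation.Binary.Reasoning.Setoid as SetoidReasoning
import Algebra.Properties.Ring as RingProperties
import Algebra.Properties.CommutativeSemiring.Exp as ExpProperties
import Algebra.Properties.Semiring.Mult as MultProperties
import Algebra.Properties.CommutativeMonoid.Sum as SumProperties
import Algebra.Properties.CommutativeSemiring.Binomial as Binomial
import Algebra.Solver.Ring.NaturalCoefficients.Default as RingSolver

module BinomialCoefficients where
  open import Data.Nat
  open import Data.Nat.Properties
  open import Data.Nat.Combinatorics
  open import Data.Nat.Primality using (euclidsLemma)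
  open import Data.Nat.Divisibility using (∣⇒≤)
  open import Data.Sum using (inj₁; inj₂)
  open import Data.Nat.Solver using (module +-*-Solver)
  open +-*-Solver
  open ≡.≡-Reasoning

  absorption : ∀ n k → suc k * (suc n C suc k) ≡ suc n * (n C k)
  absorption zero    zero    = ≡.refl
  absorption zero    (suc k) = *-zeroʳ (suc (suc k))
  absorption (suc n) zero    = ≡.trans (+-identityʳ _) (≡.trans (nC1≡n (suc (suc n))) (≡.sym (*-identityʳ _)))
  absorption (suc n) (suc k) = begin
    suc (suc k) * (suc (suc n) C suc (suc k))
                                       ≡⟨ ≡.cong (suc (suc k) *_) (nCk+nC[k+1]≡[n+1]C[k+1] (suc n) (suc k)) ⟨
    suc (suc k) * (X + Y)              ≡⟨ solve 3 (λ k X Y → (con 2 :+ k) :* (X :+ Y) := X :+ (con 1 :+ k) :* X :+ (con 2 :+ k) :* Y) ≡.refl k X Y ⟩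
    X + suc k * X + suc (suc k) * Y    ≡⟨ ≡.cong₂ (λ s t → X + s + t) (absorption n k) (absorption n (suc k)) ⟩
    X + suc n * A + suc n * B          ≡⟨ solve 4 (λ X n A B → X :+ n :* A :+ n :* B := X :+ n :* (A :+ B)) ≡.refl X (suc n) A B ⟩
    X + suc n * (A + B)                ≡⟨ ≡.cong (λ s → X + suc n * s) (nCk+nC[k+1]≡[n+1]C[k+1] n k) ⟩
    suc (suc n) * X                    ∎
    where
    X = suc n C suc k ; Y = suc n C suc (suc k) ; A = n C k ; B = n C suc k

  -- A prime p divides C(p,j) for 0 < j < p: p divides j·C(p,j) = p·C(p-1,j-1)
  -- but not j.
  prime∣choose : ∀ {p} → Prime p → ∀ {j} → 0 < j → j < p → p ∣ p C j
  prime∣choose {suc m} p-prime {suc k} _ j<p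
    with euclidsLemma (suc k) (suc m C suc k) p-prime
           (divides (m C k) (≡.trans (absorption m k) (*-comm (suc m) (m C k))))
  ... | inj₂ p∣choose = p∣choose
  ... | inj₁ p∣j      = ⊥-elim (<⇒≱ j<p (∣⇒≤ p∣j))

module _ {c ℓ} (F : Field c ℓ) where
  open Field F
  open RingProperties ring using (+-cancelˡ; +-inverseˡ-unique; +-inverseʳ-unique; x+x≈x⇒x≈0; -‿distribˡ-*; -‿distribʳ-*)
  open ExpProperties commutativeSemiring using (^-congˡ; ^-homo-*; ^-assocʳ; ^-distrib-*) renaming (_^_ to _^ᴿ_)
  open MultProperties semiring using (×-congʳ; ×1-homo-*; ×-assoc-*) renaming (_×_ to _·_)
  open SetoidReasoning setoid
  open RingSolver commutativeSemiring
  open Binomial commutativeSemiring using (binomialTerm; binomialExpansion) renaming (theorem to binomial-theorem)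
  module ∑ = SumProperties +-commutativeMonoid
  module ∏ = SumProperties *-commutativeMonoid

  inverse-cancelˡ : ∀ {a} x → ¬ a ≈ 0# → a ⁻¹ * (a * x) ≈ x
  inverse-cancelˡ {a} x a≉0 = begin
    a ⁻¹ * (a * x)  ≈⟨ solve 3 (λ a i x → i :* (a :* x) := (a :* i) :* x) refl a (a ⁻¹) x ⟩
    (a * a ⁻¹) * x  ≈⟨ *-congʳ (inverseʳ a a≉0) ⟩
    1# * x          ≈⟨ *-identityˡ x ⟩
    x               ∎

  inverse-cancelʳ : ∀ {a} x → ¬ a ≈ 0# → a * (a ⁻¹ * x) ≈ x
  inverse-cancelʳ {a} x a≉0 = trans (sym (*-assoc a (a ⁻¹) x)) (trans (*-congʳ (inverseʳ a a≉0)) (*-identityˡ x))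

  *-cancelˡ : ∀ {a x y} → ¬ a ≈ 0# → a * x ≈ a * y → x ≈ y
  *-cancelˡ {a} {x} {y} a≉0 ax≈ay = begin
    x               ≈⟨ inverse-cancelˡ x a≉0 ⟨
    a ⁻¹ * (a * x)  ≈⟨ *-congˡ ax≈ay ⟩
    a ⁻¹ * (a * y)  ≈⟨ inverse-cancelˡ y a≉0 ⟩
    y               ∎

  *-nonzero : ∀ {x y} → ¬ x ≈ 0# → ¬ y ≈ 0# → ¬ x * y ≈ 0#
  *-nonzero {x} x≉0 y≉0 xy≈0 = y≉0 (*-cancelˡ x≉0 (trans xy≈0 (sym (zeroʳ x))))

  linear-root : ∀ {u v a b} → ¬ u ≈ 0# → u * a + v * b ≈ 0# → a ≈ (- v * u ⁻¹) * b
  linear-root {u} {v} {a} {b} u≉0 root = begin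
    a                    ≈⟨ inverse-cancelˡ a u≉0 ⟨
    u ⁻¹ * (u * a)       ≈⟨ *-congˡ (+-inverseˡ-unique (u * a) (v * b) root) ⟩
    u ⁻¹ * - (v * b)     ≈⟨ *-congˡ (-‿distribˡ-* v b) ⟩
    u ⁻¹ * (- v * b)     ≈⟨ solve 3 (λ i w b → i :* (w :* b) := (w :* i) :* b) refl (u ⁻¹) (- v) b ⟩
    (- v * u ⁻¹) * b     ∎

  pow≈^ : ∀ x n → pow x n ≈ x ^ᴿ n
  pow≈^ x zero    = refl
  pow≈^ x (suc n) = *-congˡ (pow≈^ x n)

  pow-cong : ∀ {x y} n → x ≈ y → pow x n ≈ pow y n
  pow-cong {x} {y} n x≈y = trans (pow≈^ x n) (trans (^-congˡ n x≈y) (sym (pow≈^ y n)))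

  pow-homo-+ : ∀ x m n → pow x (m +ℕ n) ≈ pow x m * pow x n
  pow-homo-+ x m n = trans (pow≈^ x (m +ℕ n)) (trans (^-homo-* x m n) (sym (*-cong (pow≈^ x m) (pow≈^ x n))))

  pow-assoc : ∀ x m n → pow x (m ℕ.* n) ≈ pow (pow x m) n
  pow-assoc x m n = begin
    pow x (m ℕ.* n)    ≈⟨ pow≈^ x (m ℕ.* n) ⟩
    x ^ᴿ (m ℕ.* n)     ≈⟨ ^-assocʳ x m n ⟨
    (x ^ᴿ m) ^ᴿ n      ≈⟨ ^-congˡ n (pow≈^ x m) ⟨
    (pow x m) ^ᴿ n     ≈⟨ pow≈^ (pow x m) n ⟨
    pow (pow x m) n    ∎

  pow-distrib : ∀ x y n → pow (x * y) n ≈ pow x n * pow y n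
  pow-distrib x y n = trans (pow≈^ (x * y) n) (trans (^-distrib-* x y n) (sym (*-cong (pow≈^ x n) (pow≈^ y n))))

  pow-nonzero : ∀ {x} n → ¬ x ≈ 0# → ¬ pow x n ≈ 0#
  pow-nonzero zero    x≉0 = 1≉0
  pow-nonzero (suc n) x≉0 = *-nonzero x≉0 (pow-nonzero n x≉0)

  ·1-pow : ∀ p k → (p ^ k) · 1# ≈ pow (p · 1#) k
  ·1-pow p zero    = +-identityʳ 1#
  ·1-pow p (suc k) = trans (×1-homo-* p (p ^ k)) (*-congˡ (·1-pow p k))

  ∏-nonzero : ∀ {n} (f : Fin n → Carrier) → (∀ i → ¬ f i ≈ 0#) → ¬ ∏.sum f ≈ 0#
  ∏-nonzero {zero}  f f≉0 = 1≉0
  ∏-nonzero {suc n} f f≉0 = *-nonzero (f≉0 Fin.zero) (∏-nonzero (λ i → f (Fin.suc i)) (λ i → f≉0 (Fin.suc i)))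

  ∏-scale : ∀ {n} a (f : Fin n → Carrier) → ∏.sum (λ i → a * f i) ≈ pow a n * ∏.sum f
  ∏-scale {n} a f = trans (∏.∑-distrib-+ (λ _ → a) f) (*-congʳ (trans (∏.sum-replicate n) (sym (pow≈^ a n))))

  ∏-single-difference : ∀ {n} (f g : Fin n → Carrier) (j : Fin n) (k : Carrier) →
    (∀ i → ¬ i ≡ j → f i ≈ g i) → f j * k ≈ g j → ∏.sum f * k ≈ ∏.sum g
  ∏-single-difference {suc n} f g Fin.zero k agree at-j = begin
    (f Fin.zero * ∏.sum (λ i → f (Fin.suc i))) * k
      ≈⟨ solve 3 (λ a b c → (a :* b) :* c := (a :* c) :* b) refl (f Fin.zero) (∏.sum (λ i → f (Fin.suc i))) k ⟩
    (f Fin.zero * k) * ∏.sum (λ i → f (Fin.suc i))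
      ≈⟨ *-cong at-j (∏.sum-cong-≋ (λ i → agree (Fin.suc i) (λ ()))) ⟩
    g Fin.zero * ∏.sum (λ i → g (Fin.suc i))  ∎
  ∏-single-difference {suc n} f g (Fin.suc j) k agree at-j = begin
    (f Fin.zero * ∏.sum (λ i → f (Fin.suc i))) * k  ≈⟨ *-assoc _ _ _ ⟩
    f Fin.zero * (∏.sum (λ i → f (Fin.suc i)) * k)
      ≈⟨ *-cong (agree Fin.zero (λ ())) (∏-single-difference (λ i → f (Fin.suc i)) (λ i → g (Fin.suc i)) j k
                  (λ i i≢j → agree (Fin.suc i) (λ eq → i≢j (Finₚ.suc-injective eq))) at-j) ⟩
    g Fin.zero * ∏.sum (λ i → g (Fin.suc i))         ∎

  module FiniteField {N : ℕ} (card : HasCard F N) where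

    enum : Fin N → Carrier
    enum = proj₁ card

    enum-injective : ∀ i j → enum i ≈ enum j → i ≡ j
    enum-injective = proj₁ (proj₂ card)

    index : Carrier → Fin N
    index x = proj₁ (proj₂ (proj₂ card) x)

    enum-index : ∀ x → enum (index x) ≈ x
    enum-index x = proj₂ (proj₂ (proj₂ card) x)

    zero-index : Fin N
    zero-index = index 0#

    _≈0? : ∀ x → Dec (x ≈ 0#)
    x ≈0? with index x Fin.≟ zero-index
    ... | yes same = yes (trans (sym (enum-index x)) (trans (reflexive (≡.cong enum same)) (enum-index 0#)))
    ... | no differ = no (λ x≈0 → differ (enum-injective _ _ (trans (enum-index x) (trans x≈0 (sym (enum-index 0#))))))

    enum-nonzero : ∀ i → ¬ i ≡ zero-index → ¬ enum i ≈ 0#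
    enum-nonzero i i≢0 enum≈0 = i≢0 (enum-injective _ _ (trans enum≈0 (sym (enum-index 0#))))

    reindexed : (Carrier → Carrier) → Fin N → Fin N
    reindexed f i = index (f (enum i))

    reindexed-inverse : ∀ (f g : Carrier → Carrier) → (∀ {x y} → x ≈ y → f x ≈ f y) →
      (∀ x → f (g x) ≈ x) → ∀ i → reindexed f (reindexed g i) ≡ i
    reindexed-inverse f g f-cong fg i = enum-injective _ _ (begin
      enum (index (f (enum (index (g (enum i))))))  ≈⟨ enum-index _ ⟩
      f (enum (index (g (enum i))))                 ≈⟨ f-cong (enum-index _) ⟩
      f (g (enum i))                                ≈⟨ fg (enum i) ⟩
      enum i                                        ∎)

    reindex : (f g : Carrier → Carrier) →
      (∀ {x y} → x ≈ y → f x ≈ f y) → (∀ {x y} → x ≈ y → g x ≈ g y) →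
      (∀ x → f (g x) ≈ x) → (∀ x → g (f x) ≈ x) → Permutation N N
    reindex f g f-cong g-cong fg gf =
      permutation (reindexed f) (reindexed g) (reindexed-inverse f g f-cong fg) (reindexed-inverse g f g-cong gf)

    -- Translation by 1 permutes F, so Σ x = Σ (x + 1) = Σ x + N·1.
    characteristic : N · 1# ≈ 0#
    characteristic = +-cancelˡ S (N · 1#) 0# (begin
      S + N · 1#                       ≈⟨ +-congˡ (∑.sum-replicate N) ⟨
      S + ∑.sum (λ (_ : Fin N) → 1#)   ≈⟨ ∑.∑-distrib-+ enum (λ _ → 1#) ⟨
      ∑.sum (λ i → enum i + 1#)        ≈⟨ ∑.sum-cong-≋ (λ i → enum-index (enum i + 1#)) ⟨
      ∑.sum (λ i → enum (index (enum i + 1#)))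
        ≈⟨ ∑.sum-permute enum (reindex (_+ 1#) (_+ - 1#) +-congʳ +-congʳ (shift (-‿inverseʳ 1#)) (shift (-‿inverseˡ 1#))) ⟨
      S                                ≈⟨ +-identityʳ S ⟨
      S + 0#                           ∎)
      where
      S = ∑.sum enum
      shift : ∀ {a b} → a + b ≈ 0# → ∀ x → x + b + a ≈ x
      shift {a} {b} a+b≈0 x = trans (+-assoc x b a) (trans (+-congˡ (trans (+-comm b a) a+b≈0)) (+-identityʳ x))

    -- If N = p^k then p·1 = 0: (p·1)^k = N·1 = 0 and F has no nilpotents.
    prime-characteristic : ∀ {p k} → N ≡ p ^ k → p · 1# ≈ 0#
    prime-characteristic {p} {k} N≡p^k with (p · 1#) ≈0?
    ... | yes p·1≈0 = p·1≈0
    ... | no  p·1≉0 = ⊥-elim (pow-nonzero k p·1≉0 (begin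
      pow (p · 1#) k  ≈⟨ ·1-pow p k ⟨
      (p ^ k) · 1#    ≡⟨ ≡.cong (_· 1#) N≡p^k ⟨
      N · 1#          ≈⟨ characteristic ⟩
      0#              ∎))

    unit : Fin N → Carrier
    unit i with i Fin.≟ zero-index
    ... | yes _ = 1#
    ... | no  _ = enum i

    unit-zero : unit zero-index ≈ 1#
    unit-zero with zero-index Fin.≟ zero-index
    ... | yes _   = refl
    ... | no  i≢i = ⊥-elim (i≢i ≡.refl)

    unit-other : ∀ i → ¬ i ≡ zero-index → unit i ≈ enum i
    unit-other i i≢0 with i Fin.≟ zero-index
    ... | yes i≡0 = ⊥-elim (i≢0 i≡0)
    ... | no  _   = refl

    unit-nonzero : ∀ i → ¬ unit i ≈ 0#
    unit-nonzero i with i Fin.≟ zero-index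
    ... | yes _   = 1≉0
    ... | no  i≢0 = enum-nonzero i i≢0

    -- Fermat for units: multiplication by a ≠ 0 permutes the units, so
    -- ∏ units · a = aᴺ · ∏ units.
    fermat-unit : ∀ a → ¬ a ≈ 0# → pow a N ≈ a
    fermat-unit a a≉0 = sym (*-cancelˡ (∏-nonzero unit unit-nonzero) (begin
      ∏.sum unit * a                          ≈⟨ *-congʳ (∏.sum-permute unit π) ⟩
      ∏.sum (λ i → unit (reindexed (a *_) i)) * a
        ≈⟨ ∏-single-difference _ (λ i → a * unit i) zero-index a scale-other scale-zero ⟩
      ∏.sum (λ i → a * unit i)                ≈⟨ ∏-scale a unit ⟩
      pow a N * ∏.sum unit                    ≈⟨ *-comm _ _ ⟩
      ∏.sum unit * pow a N                    ∎))
      where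
      π = reindex (a *_) (a ⁻¹ *_) *-congˡ *-congˡ (λ x → inverse-cancelʳ x a≉0) (λ x → inverse-cancelˡ x a≉0)
      σ = reindexed (a *_)
      σ-zero : σ zero-index ≡ zero-index
      σ-zero = enum-injective _ _ (trans (enum-index _) (trans (*-congˡ (enum-index 0#)) (trans (zeroʳ a) (sym (enum-index 0#)))))
      σ-other : ∀ i → ¬ i ≡ zero-index → ¬ σ i ≡ zero-index
      σ-other i i≢0 σi≡0 = *-nonzero a≉0 (enum-nonzero i i≢0)
        (trans (sym (enum-index _)) (trans (reflexive (≡.cong enum σi≡0)) (enum-index 0#)))
      scale-other : ∀ i → ¬ i ≡ zero-index → unit (σ i) ≈ a * unit i
      scale-other i i≢0 = trans (unit-other (σ i) (σ-other i i≢0)) (trans (enum-index _) (*-congˡ (sym (unit-other i i≢0))))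
      scale-zero : unit (σ zero-index) * a ≈ a * unit zero-index
      scale-zero = trans (*-congʳ (reflexive (≡.cong unit σ-zero))) (*-comm _ _)

    -- Fermat's little theorem: x^N = x for every x (N ≠ 0 as F has an element).
    fermat : ∀ x → pow x N ≈ x
    fermat x with x ≈0?
    ... | no  x≉0 = fermat-unit x x≉0
    ... | yes x≈0 = trans (pow-cong N x≈0) (trans (pow-zero zero-index) (sym x≈0))
      where
      pow-zero : ∀ {n} → Fin n → pow 0# n ≈ 0#
      pow-zero {suc n} _ = zeroˡ (pow 0# n)

  binomial-extremes : ∀ m → (∀ j z → 0 ℕ.< j → j ℕ.< suc m → (suc m C j) · z ≈ 0#) →
    ∀ x y → (x + y) ^ᴿ suc m ≈ x ^ᴿ suc m + y ^ᴿ suc m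
  binomial-extremes m middle x y = begin
    (x + y) ^ᴿ suc m                             ≈⟨ binomial-theorem (suc m) x y ⟩
    binomialExpansion x y (suc m)                ≈⟨ ∑.sum-init-last t ⟩
    (t Fin.zero + ∑.sum (λ i → t (Fin.suc (Fin.inject₁ i)))) + t (Fin.fromℕ (suc m))
      ≈⟨ +-cong (+-cong first (trans (∑.sum-cong-≋ inner) (∑.sum-replicate-zero m))) (last (Finₚ.toℕ-fromℕ (suc m))) ⟩
    (y ^ᴿ suc m + 0#) + x ^ᴿ suc m               ≈⟨ +-congʳ (+-identityʳ _) ⟩
    y ^ᴿ suc m + x ^ᴿ suc m                      ≈⟨ +-comm _ _ ⟩
    x ^ᴿ suc m + y ^ᴿ suc m                      ∎
    where
    t = binomialTerm x y (suc m)
    first : t Fin.zero ≈ y ^ᴿ suc m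
    first = trans (+-identityʳ _) (*-identityˡ _)
    inner : ∀ (i : Fin m) → t (Fin.suc (Fin.inject₁ i)) ≈ 0#
    inner i = middle _ _ (ℕ.s≤s ℕ.z≤n) (ℕ.s≤s (≡.subst (ℕ._< m) (≡.sym (Finₚ.toℕ-inject₁ i)) (Finₚ.toℕ<n i)))
    last : ∀ {j} → j ≡ suc m → (suc m C j) · (x ^ᴿ j * y ^ᴿ (suc m ∸ j)) ≈ x ^ᴿ suc m
    last ≡.refl rewrite nCn≡1 (suc m) | ℕₚ.n∸n≡0 m = trans (+-identityʳ _) (*-identityʳ _)

  module Frobenius {p : ℕ} (p-prime : Prime p) (char-p : p · 1# ≈ 0#) where

    multiple-vanishes : ∀ {n} z → p ∣ n → n · z ≈ 0#
    multiple-vanishes z (divides r ≡.refl) = begin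
      (r ℕ.* p) · z                ≈⟨ ×-congʳ (r ℕ.* p) (*-identityˡ z) ⟨
      (r ℕ.* p) · (1# * z)         ≈⟨ ×-assoc-* (r ℕ.* p) 1# z ⟨
      ((r ℕ.* p) · 1#) * z         ≈⟨ *-congʳ (×1-homo-* r p) ⟩
      ((r · 1#) * (p · 1#)) * z    ≈⟨ *-congʳ (*-congˡ char-p) ⟩
      ((r · 1#) * 0#) * z          ≈⟨ trans (*-congʳ (zeroʳ _)) (zeroˡ z) ⟩
      0#                           ∎

    -- Freshman's dream: (x + y)^p = x^p + y^p, as p ∣ C(p,j) for 0 < j < p.
    pow-p-additive : ∀ x y → pow (x + y) p ≈ pow x p + pow y p
    pow-p-additive x y = additive p-prime ≡.refl
      where
      -- generalised over p so that p = m + 1 can be matched (Prime 0 is empty)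
      additive : ∀ {n} → Prime n → n ≡ p → pow (x + y) n ≈ pow x n + pow y n
      additive {suc m} _ ≡.refl = begin
        pow (x + y) (suc m)             ≈⟨ pow≈^ (x + y) (suc m) ⟩
        (x + y) ^ᴿ suc m                ≈⟨ binomial-extremes m middle x y ⟩
        x ^ᴿ suc m + y ^ᴿ suc m         ≈⟨ +-cong (pow≈^ x (suc m)) (pow≈^ y (suc m)) ⟨
        pow x (suc m) + pow y (suc m)   ∎
        where
        middle : ∀ j z → 0 ℕ.< j → j ℕ.< suc m → (suc m C j) · z ≈ 0#
        middle j z 0<j j<p = multiple-vanishes z (BinomialCoefficients.prime∣choose p-prime 0<j j<p)

    pow-p^k-additive : ∀ k x y → pow (x + y) (p ^ k) ≈ pow x (p ^ k) + pow y (p ^ k)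
    pow-p^k-additive zero    x y = trans (*-identityʳ (x + y)) (sym (+-cong (*-identityʳ x) (*-identityʳ y)))
    pow-p^k-additive (suc k) x y = begin
      pow (x + y) (p ℕ.* p ^ k)                          ≈⟨ pow-assoc (x + y) p (p ^ k) ⟩
      pow (pow (x + y) p) (p ^ k)                        ≈⟨ pow-cong (p ^ k) (pow-p-additive x y) ⟩
      pow (pow x p + pow y p) (p ^ k)                    ≈⟨ pow-p^k-additive k (pow x p) (pow y p) ⟩
      pow (pow x p) (p ^ k) + pow (pow y p) (p ^ k)      ≈⟨ +-cong (pow-assoc x p (p ^ k)) (pow-assoc y p (p ^ k)) ⟨
      pow x (p ℕ.* p ^ k) + pow y (p ℕ.* p ^ k)          ∎

  additive⇒neg : (f : Carrier → Carrier) → (∀ {x y} → x ≈ y → f x ≈ f y) →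
    (∀ x y → f (x + y) ≈ f x + f y) → ∀ x → f (- x) ≈ - f x
  additive⇒neg f f-cong f-additive x = +-inverseʳ-unique (f x) (f (- x)) (begin
    f x + f (- x)  ≈⟨ f-additive x (- x) ⟨
    f (x + - x)    ≈⟨ f-cong (-‿inverseʳ x) ⟩
    f 0#           ≈⟨ x+x≈x⇒x≈0 (f 0#) (trans (sym (f-additive 0# 0#)) (f-cong (+-identityʳ 0#))) ⟩
    0#             ∎)

  semilinear : (f : Carrier → Carrier) →
    (∀ x y → f (x + y) ≈ f x + f y) → (∀ x y → f (x * y) ≈ f x * f y) →
    ∀ a x b y → f (a * x + b * y) ≈ f a * f x + f b * f y
  semilinear f f-additive f-mul a x b y =
    trans (f-additive (a * x) (b * y)) (+-cong (f-mul a x) (f-mul b y))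

  module CubicExtension (q₀ : ℕ)
      (φ-additive : ∀ x y → pow (x + y) (suc q₀) ≈ pow x (suc q₀) + pow y (suc q₀))
      (fermat : ∀ x → pow x (suc q₀ ^ 3) ≈ x) where

    q : ℕ
    q = suc q₀

    φ ψ : Carrier → Carrier
    φ x = pow x q
    ψ x = pow x (q ^ 2)

    φ-cong : ∀ {x y} → x ≈ y → φ x ≈ φ y
    φ-cong = pow-cong q

    ψ-cong : ∀ {x y} → x ≈ y → ψ x ≈ ψ y
    ψ-cong = pow-cong (q ^ 2)

    φ-mul : ∀ x y → φ (x * y) ≈ φ x * φ y
    φ-mul x y = pow-distrib x y q

    ψ-mul : ∀ x y → ψ (x * y) ≈ ψ x * ψ y
    ψ-mul x y = pow-distrib x y (q ^ 2)

    ψ≈φ∘φ : ∀ x → ψ x ≈ φ (φ x)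
    ψ≈φ∘φ x = trans (pow-assoc x q (q ℕ.* 1)) (trans (pow-assoc (φ x) q 1) (*-identityʳ _))

    ψ-additive : ∀ x y → ψ (x + y) ≈ ψ x + ψ y
    ψ-additive x y = begin
      ψ (x + y)            ≈⟨ ψ≈φ∘φ (x + y) ⟩
      φ (φ (x + y))        ≈⟨ φ-cong (φ-additive x y) ⟩
      φ (φ x + φ y)        ≈⟨ φ-additive (φ x) (φ y) ⟩
      φ (φ x) + φ (φ y)    ≈⟨ +-cong (ψ≈φ∘φ x) (ψ≈φ∘φ y) ⟨
      ψ x + ψ y            ∎

    φ³≈id : ∀ x → φ (φ (φ x)) ≈ x
    φ³≈id x = trans (sym (ψ≈φ∘φ (φ x))) (trans (sym (pow-assoc x q (q ^ 2))) (fermat x))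

    φ∘ψ : ∀ x → φ (ψ x) ≈ x
    φ∘ψ x = trans (φ-cong (ψ≈φ∘φ x)) (φ³≈id x)

    ψ∘φ : ∀ x → ψ (φ x) ≈ x
    ψ∘φ x = trans (ψ≈φ∘φ (φ x)) (φ³≈id x)

    ψ∘ψ : ∀ x → ψ (ψ x) ≈ φ x
    ψ∘ψ x = trans (ψ-cong (ψ≈φ∘φ x)) (ψ∘φ (φ x))

    Tr-additive : ∀ x y → Tr F q (x + y) ≈ Tr F q x + Tr F q y
    Tr-additive x y = trans (+-cong (+-congˡ (φ-additive x y)) (ψ-additive x y))
      (solve 6 (λ a b c d e f → a :+ b :+ (c :+ d) :+ (e :+ f) := a :+ c :+ e :+ (b :+ d :+ f)) refl x y (φ x) (φ y) (ψ x) (ψ y))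

    Tr-cong : ∀ {x y} → x ≈ y → Tr F q x ≈ Tr F q y
    Tr-cong x≈y = +-cong (+-cong x≈y (φ-cong x≈y)) (ψ-cong x≈y)

    Tr-neg : ∀ x → Tr F q (- x) ≈ - Tr F q x
    Tr-neg = additive⇒neg (Tr F q) Tr-cong Tr-additive

    Nm-expand : ∀ x → Nm F q x ≈ ψ x * φ x * x
    Nm-expand x = trans (pow-homo-+ x (q ^ 2 +ℕ q) 1)
      (*-cong (pow-homo-+ x (q ^ 2) q) (*-identityʳ x))

    module Roots (u v : Carrier) (u≉0 : ¬ u ≈ 0#) (norm≉1 : ¬ Nm F q ((- v) * (u ⁻¹)) ≈ 1#) where

      γ : Carrier
      γ = pow u (q ^ 2) * pow v q

      -- E y is the left side of the equation without β, scaled by γ;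
      -- D y = u y^(q²) + v y^q is y·E y / γ.
      E D : Carrier → Carrier
      E y = γ * (u * pow y (q ^ 2 ∸ 1) + v * pow y (q ∸ 1))
      D y = u * ψ y + v * φ y

      y·E≈γ·D : ∀ y → y * E y ≈ γ * D y
      y·E≈γ·D y = solve 6 (λ y γ u v A B → y :* (γ :* (u :* A :+ v :* B)) := γ :* (u :* (y :* A) :+ v :* (y :* B)))
        refl y γ u v (pow y (q ^ 2 ∸ 1)) (pow y (q ∸ 1))

      -- D y = 0 would give ψ y = r φ y with r = -v/u; conjugating yields
      -- y = φ r ψ y and φ y = ψ r y, and multiplying the three, N r = 1.
      D-nonzero : ∀ y → ¬ y ≈ 0# → ¬ D y ≈ 0#
      D-nonzero y y≉0 D≈0 = norm≉1 (trans (Nm-expand r) (*-cancelˡ Y≉0 (begin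
        Y * (ψ r * φ r * r)                       ≈⟨ solve 6 (λ y y₁ y₂ r r₁ r₂ → y :* y₁ :* y₂ :* (r₂ :* r₁ :* r) := (r₁ :* y₂) :* (r₂ :* y) :* (r :* y₁)) refl y (φ y) (ψ y) r (φ r) (ψ r) ⟩
        (φ r * ψ y) * (ψ r * y) * (r * φ y)       ≈⟨ *-cong (*-cong conj-φ conj-ψ) root ⟨
        Y                                         ≈⟨ *-identityʳ Y ⟨
        Y * 1#                                    ∎)))
        where
        r = (- v) * (u ⁻¹)
        Y = y * φ y * ψ y
        Y≉0 : ¬ Y ≈ 0#
        Y≉0 = *-nonzero (*-nonzero y≉0 (pow-nonzero q y≉0)) (pow-nonzero (q ^ 2) y≉0)
        root : ψ y ≈ r * φ y
        root = linear-root u≉0 D≈0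
        conj-φ : y ≈ φ r * ψ y
        conj-φ = trans (sym (φ∘ψ y)) (trans (φ-cong root) (trans (φ-mul r (φ y)) (*-congˡ (sym (ψ≈φ∘φ y)))))
        conj-ψ : φ y ≈ ψ r * y
        conj-ψ = trans (sym (ψ∘ψ y)) (trans (ψ-cong root) (trans (ψ-mul r (φ y)) (*-congˡ (ψ∘φ y))))

      φ-γ : φ γ ≈ u * ψ v
      φ-γ = trans (φ-mul (ψ u) (φ v)) (*-cong (φ∘ψ u) (sym (ψ≈φ∘φ v)))

      ψ-γ : ψ γ ≈ φ u * v
      ψ-γ = trans (ψ-mul (ψ u) (φ v)) (*-cong (ψ∘ψ u) (ψ∘φ v))

      φ-D : ∀ y → φ (D y) ≈ φ u * y + φ v * ψ y
      φ-D y = trans (semilinear φ φ-additive φ-mul u (ψ y) v (φ y))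
        (+-cong (*-congˡ (φ∘ψ y)) (*-congˡ (sym (ψ≈φ∘φ y))))

      ψ-D : ∀ y → ψ (D y) ≈ ψ u * φ y + ψ v * y
      ψ-D y = trans (semilinear ψ ψ-additive ψ-mul u (ψ y) v (φ y))
        (+-cong (*-congˡ (ψ∘ψ y)) (*-congˡ (ψ∘φ y)))

      conjugate : (f : Carrier → Carrier) → (∀ {x y} → x ≈ y → f x ≈ f y) → (∀ x y → f (x * y) ≈ f x * f y) →
        ∀ y → f y * f (E y) ≈ f γ * f (D y)
      conjugate f f-cong f-mul y = trans (sym (f-mul y (E y))) (trans (f-cong (y·E≈γ·D y)) (f-mul γ (D y)))

      norm-identity : ∀ y → (y * φ y * ψ y) * (Tr F q (E y) + (Nm F q u + Nm F q v)) ≈ D y * φ (D y) * ψ (D y)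
      norm-identity y = begin
        (y * φ y * ψ y) * (Tr F q (E y) + (Nm F q u + Nm F q v))
          ≈⟨ solve 8 (λ y y₁ y₂ e e₁ e₂ n n′ → (y :* y₁ :* y₂) :* (e :+ e₁ :+ e₂ :+ (n :+ n′))
                := (y₁ :* y₂) :* (y :* e) :+ (y :* y₂) :* (y₁ :* e₁) :+ (y :* y₁) :* (y₂ :* e₂) :+ (y :* y₁ :* y₂) :* (n :+ n′))
               refl y (φ y) (ψ y) (E y) (φ (E y)) (ψ (E y)) (Nm F q u) (Nm F q v) ⟩
        (φ y * ψ y) * (y * E y) + (y * ψ y) * (φ y * φ (E y)) + (y * φ y) * (ψ y * ψ (E y))
          + (y * φ y * ψ y) * (Nm F q u + Nm F q v)
          ≈⟨ +-cong (+-cong (+-cong (*-congˡ (y·E≈γ·D y))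
                                    (*-congˡ (trans (conjugate φ φ-cong φ-mul y) (*-cong φ-γ (φ-D y)))))
                            (*-congˡ (trans (conjugate ψ ψ-cong ψ-mul y) (*-cong ψ-γ (ψ-D y)))))
                    (*-congˡ (+-cong (Nm-expand u) (Nm-expand v))) ⟩
        (φ y * ψ y) * ((ψ u * φ v) * (u * ψ y + v * φ y)) + (y * ψ y) * ((u * ψ v) * (φ u * y + φ v * ψ y))
          + (y * φ y) * ((φ u * v) * (ψ u * φ y + ψ v * y)) + (y * φ y * ψ y) * (ψ u * φ u * u + ψ v * φ v * v)
          ≈⟨ solve 9 (λ a a₁ a₂ b b₁ b₂ y y₁ y₂ →
                (y₁ :* y₂) :* ((a₂ :* b₁) :* (a :* y₂ :+ b :* y₁)) :+ (y :* y₂) :* ((a :* b₂) :* (a₁ :* y :+ b₁ :* y₂))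
                  :+ (y :* y₁) :* ((a₁ :* b) :* (a₂ :* y₁ :+ b₂ :* y)) :+ (y :* y₁ :* y₂) :* (a₂ :* a₁ :* a :+ b₂ :* b₁ :* b)
                := (a :* y₂ :+ b :* y₁) :* (a₁ :* y :+ b₁ :* y₂) :* (a₂ :* y₁ :+ b₂ :* y))
               refl u (φ u) (ψ u) v (φ v) (ψ v) y (φ y) (ψ y) ⟩
        D y * (φ u * y + φ v * ψ y) * (ψ u * φ y + ψ v * y)
          ≈⟨ *-cong (*-congˡ (φ-D y)) (ψ-D y) ⟨
        D y * φ (D y) * ψ (D y)  ∎

      trace-norm-nonzero : ∀ y → ¬ y ≈ 0# → ¬ Tr F q (E y) + (Nm F q u + Nm F q v) ≈ 0#
      trace-norm-nonzero y y≉0 T≈0 = *-nonzero (*-nonzero D≉0 (pow-nonzero q D≉0)) (pow-nonzero (q ^ 2) D≉0) (begin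
        D y * φ (D y) * ψ (D y)                                          ≈⟨ norm-identity y ⟨
        (y * φ y * ψ y) * (Tr F q (E y) + (Nm F q u + Nm F q v))         ≈⟨ *-congˡ T≈0 ⟩
        (y * φ y * ψ y) * 0#                                             ≈⟨ zeroʳ _ ⟩
        0#                                                               ∎)
        where
        D≉0 = D-nonzero y y≉0

      -- First claim: for β ∈ 𝓑 the equation has no nonzero root, since a root
      -- x gives γ β = -E x and so Tr (E x) + N u + N v = Tr (E x) + Tr (γ β) = 0.
      no-root : ∀ β → Tr F q (γ * β) ≈ Nm F q u + Nm F q v →
        ∀ x → ¬ x ≈ 0# → ¬ (u * pow x (q ^ 2 ∸ 1) + v * pow x (q ∸ 1) + β) ≈ 0#
      no-root β β∈𝓑 x x≉0 root = trace-norm-nonzero x x≉0 (begin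
        Tr F q (E x) + (Nm F q u + Nm F q v)  ≈⟨ +-congˡ β∈𝓑 ⟨
        Tr F q (E x) + Tr F q (γ * β)         ≈⟨ +-congˡ (trans (Tr-cong γ·β≈-E) (Tr-neg (E x))) ⟩
        Tr F q (E x) + - Tr F q (E x)         ≈⟨ -‿inverseʳ _ ⟩
        0#                                    ∎)
        where
        W = u * pow x (q ^ 2 ∸ 1) + v * pow x (q ∸ 1)
        γ·β≈-E : γ * β ≈ - E x
        γ·β≈-E = trans (*-congˡ (+-inverseʳ-unique W β root)) (sym (-‿distribʳ-* γ W))

      -- Second claim: for θ ∈ 𝓑 the argument of the trace is E (a x) + γ θ,
      -- so the trace is Tr (E (a x)) + N u + N v.
      no-trace-root : ∀ θ → Tr F q (γ * θ) ≈ Nm F q u + Nm F q v →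
        ∀ a → ¬ a ≈ 0# → ∀ x → ¬ x ≈ 0# →
        ¬ Tr F q ((γ * (u * pow a (q ^ 2 ∸ 1) * pow x (q ^ 2) + v * pow a (q ∸ 1) * pow x q + θ * x)) * x ⁻¹) ≈ 0#
      no-trace-root θ θ∈𝓑 a a≉0 x x≉0 trace≈0 = trace-norm-nonzero (a * x) (*-nonzero a≉0 x≉0) (begin
        Tr F q (E (a * x)) + (Nm F q u + Nm F q v)  ≈⟨ +-congˡ θ∈𝓑 ⟨
        Tr F q (E (a * x)) + Tr F q (γ * θ)         ≈⟨ Tr-additive (E (a * x)) (γ * θ) ⟨
        Tr F q (E (a * x) + γ * θ)                  ≈⟨ Tr-cong argument ⟨
        Tr F q ((γ * (u * A₂ * pow x (q ^ 2) + v * A₁ * pow x q + θ * x)) * x ⁻¹)  ≈⟨ trace≈0 ⟩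
        0#                                          ∎)
        where
        A₂ = pow a (q ^ 2 ∸ 1)
        A₁ = pow a (q ∸ 1)
        X₂ = pow x (q ^ 2 ∸ 1)
        X₁ = pow x (q ∸ 1)
        -- x^(q^2) = x · x^(q²-1) and x^q = x · x^(q-1) hold by computation.
        argument : (γ * (u * A₂ * pow x (q ^ 2) + v * A₁ * pow x q + θ * x)) * x ⁻¹ ≈ E (a * x) + γ * θ
        argument = begin
          (γ * (u * A₂ * pow x (q ^ 2) + v * A₁ * pow x q + θ * x)) * x ⁻¹
            ≈⟨ solve 10 (λ γ u v θ x x⁻¹ A₂ X₂ A₁ X₁ →
                 (γ :* (u :* A₂ :* (x :* X₂) :+ v :* A₁ :* (x :* X₁) :+ θ :* x)) :* x⁻¹
                 := γ :* (u :* (A₂ :* X₂) :+ v :* (A₁ :* X₁) :+ θ) :* (x :* x⁻¹)) refl γ u v θ x (x ⁻¹) A₂ X₂ A₁ X₁ ⟩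
          γ * (u * (A₂ * X₂) + v * (A₁ * X₁) + θ) * (x * x ⁻¹)
            ≈⟨ *-cong (*-congˡ (+-congʳ (+-cong (*-congˡ (sym (pow-distrib a x (q ^ 2 ∸ 1))))
                                                (*-congˡ (sym (pow-distrib a x (q ∸ 1)))))))
                      (inverseʳ x x≉0) ⟩
          γ * (u * pow (a * x) (q ^ 2 ∸ 1) + v * pow (a * x) (q ∸ 1) + θ) * 1#
            ≈⟨ *-identityʳ _ ⟩
          γ * (u * pow (a * x) (q ^ 2 ∸ 1) + v * pow (a * x) (q ∸ 1) + θ)
            ≈⟨ distribˡ γ _ θ ⟩
          E (a * x) + γ * θ  ∎

theorem3p7 : ∀ {c ℓ : Level} (q : ℕ) → IsPrimePower q →
    (F : Field c ℓ) → HasCard F (q ^ 3) →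
    let open Field F in
    (u v : Carrier) → ¬ (u ≈ 0#) → ¬ (v ≈ 0#) →
    ¬ (Nm F q ((- v) * (u ⁻¹)) ≈ 1#) →
    ((β : Carrier) →
      Tr F q (pow u (q ^ 2) * pow v q * β) ≈ pow u (q ^ 2 +ℕ q +ℕ 1) + pow v (q ^ 2 +ℕ q +ℕ 1) →
      (x : Carrier) → ¬ (x ≈ 0#) →
      ¬ ((u * pow x (q ^ 2 ∸ 1) + v * pow x (q ∸ 1) + β) ≈ 0#))
    ×
    ((θ : Carrier) →
      Tr F q (pow u (q ^ 2) * pow v q * θ) ≈ pow u (q ^ 2 +ℕ q +ℕ 1) + pow v (q ^ 2 +ℕ q +ℕ 1) →
      (a : Carrier) → ¬ (a ≈ 0#) →
      (x : Carrier) → ¬ (x ≈ 0#) →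
      ¬ (Tr F q ((pow u (q ^ 2) * pow v q
                   * (u * pow a (q ^ 2 ∸ 1) * pow x (q ^ 2)
                      + v * pow a (q ∸ 1) * pow x q
                      + θ * x)) * (x ⁻¹)) ≈ 0#))
theorem3p7 zero _ F card = ⊥-elim (Finₚ.¬Fin0 (FiniteField.zero-index F card))
theorem3p7 (suc q₀) (p , k , p-prime , _ , q≡p^k) F card u v u≉0 _ norm≉1 = no-root , no-trace-root
  where
  open Field F
  open FiniteField F card using (prime-characteristic; fermat)

  -- |F| = q³ = p^(3k), so F has characteristic p ...
  open Frobenius F p-prime (prime-characteristic {p} {k ℕ.* 3} (≡.trans (≡.cong (_^ 3) q≡p^k) (ℕₚ.^-*-assoc p k 3)))
    using (pow-p^k-additive)

  -- ... and x ↦ x^q = x^(p^k) is additive.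
  φ-additive : ∀ x y → pow (x + y) (suc q₀) ≈ pow x (suc q₀) + pow y (suc q₀)
  φ-additive x y = ≡.subst (λ n → pow (x + y) n ≈ pow x n + pow y n) (≡.sym q≡p^k) (pow-p^k-additive k x y)

  open CubicExtension F q₀ φ-additive fermat
  open Roots u v u≉0 norm≉1
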